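{- Let $q$ be a prime power, $m,n,\lambda$ positive integers and $\Gamma$ a simple graph. If there exist an $(mn,n,\Gamma,\lambda)$-GDD over $\mathbb{F}_q$ and a spanning $2$-$([n]_q,\Gamma,\lambda)$ design, then there exists a $2$-$(mn,\Gamma,\lambda)$ design over $\mathbb{F}_q$.
   Context: For a prime power $q$, $[n]_q=\frac{q^n-1}{q-1}$; $\mathrm{PG}(\mathbb{F}_q^v)$ is the $(v-1)$-dimensional projective space over $\mathbb{F}_q$ ($[v]_q$ points; subspaces are point sets of linear subspaces). A $2$-$(N,\Gamma,\lambda)$ design is a pair $(\mathcal{P},\mathcal{B})$ with $|\mathcal{P}|=N$ and $\mathcal{B}$ a collection of subgraphs of the complete graph on $\mathcal{P}$ isomorphic to $\Gamma$ such that any two distinct points are adjacent in exactly $\lambda$ blocks; it is spanning if $\Gamma$ has exactly $N$ vertices. A $\Gamma$-subspace of $\mathrm{PG}(\mathbb{F}_q^v)$ is a graph isomorphic to $\Gamma$ whose vertex set is a subspace of $\mathrm{PG}(\mathbb{F}_q^v)$. A $2$-$(v,\Gamma,\lambda)$ design over $\mathbb{F}_q$ is a collection of $\Gamma$-subspaces of $\mathrm{PG}(\mathbb{F}_q^v)$ such that any two distinct points are adjacent in exactly $\lambda$ of them. An $(n-1)$-spread of $\mathrm{PG}(\mathbb{F}_q^{mn})$ is a partition of its points into $(n-1)$-dimensional projective subspaces. An $(mn,n,\Gamma,\lambda)$-GDD over $\mathbb{F}_q$ consists of an $(n-1)$-spread $\mathcal{S}$ of $\mathrm{PG}(\mathbb{F}_q^{mn})$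 (classes) and a collection of $\Gamma$-subspaces of $\mathrm{PG}(\mathbb{F}_q^{mn})$ such that no edge of a block joins two points of the same class, and any two points in different classes are adjacent in exactly $\lambda$ blocks. -}

module Defs where

open import Level using (0ℓ)
open import Data.Nat using (ℕ; zero; suc; _^_)
import Data.Nat as ℕ
open import Data.Fin using (Fin)
import Data.Fin
open import Data.Vec using (Vec; []; _∷_; replicate; zipWith; map)
open import Data.List using (List; []; _∷_)
open import Data.List.Relation.Unary.Any using (Any)
open import Data.Product using (Σ; ∃; ∃-syntax; _×_; _,_; proj₁)
open import Relation.Binary.PropositionalEquality using (_≡_; _≢_)
open import Relation.Nullary using (¬_)
open import Function.Bundles using (_↔_; _⇔_)

record Field : Set₁ where
  infixl 6 _+_
  infixl 7 _*_
  field
    Carrier : Set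
    _+_ _*_ : Carrier → Carrier → Carrier
    -_      : Carrier → Carrier
    0# 1#   : Carrier
    +-assoc : ∀ x y z → (x + y) + z ≡ x + (y + z)
    +-comm  : ∀ x y → x + y ≡ y + x
    +-identityˡ : ∀ x → 0# + x ≡ x
    -‿inverseˡ  : ∀ x → (- x) + x ≡ 0#
    *-assoc : ∀ x y z → (x * y) * z ≡ x * (y * z)
    *-comm  : ∀ x y → x * y ≡ y * x
    *-identityˡ : ∀ x → 1# * x ≡ x
    distribˡ : ∀ x y z → x * (y + z) ≡ (x * y) + (x * z)
    0≢1 : 0# ≢ 1#
    inverse : ∀ x → x ≢ 0# → ∃[ y ] (y * x ≡ 1#)

-- A field with exactly q elements (F_q); q is then necessarily a prime power.
record FiniteField (q : ℕ) : Set₁ where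
  field
    field′ : Field
  open Field field′ public
  field
    card : Carrier ↔ Fin q

-- Gaussian number [n]_q = (q^n - 1)/(q - 1) = 1 + q + ... + q^(n-1)
[_]_ : ℕ → ℕ → ℕ
[ zero ] q = 0
[ suc n ] q = q ^ n ℕ.+ [ n ] q

data Count {a} {A : Set a} (P : A → Set) : List A → ℕ → Set a where
  c-nil  : Count P [] 0
  c-yes  : ∀ {x xs k} → P x → Count P xs k → Count P (x ∷ xs) (suc k)
  c-no   : ∀ {x xs k} → ¬ P x → Count P xs k → Count P (x ∷ xs) k

record SimpleGraph : Set₁ where
  field
    vertices : ℕ
    Adj      : Fin vertices → Fin vertices → Set
    sym      : ∀ {i j} → Adj i j → Adj j i
    irrefl   : ∀ {i} → ¬ Adj i i

-- Ordinary 2-(N,Γ,λ) designs on the point set Fin N.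
-- A block is a copy of Γ in K_N, given by an injective vertex map
-- (the block's edges are the images of the edges of Γ).

module _ (Γ : SimpleGraph) where
  open SimpleGraph Γ

  record Copy (N : ℕ) : Set where
    field
      emb : Fin vertices → Fin N
      inj : ∀ i j → emb i ≡ emb j → i ≡ j

  AdjInCopy : ∀ {N} → Copy N → Fin N → Fin N → Set
  AdjInCopy B x y = ∃[ i ] ∃[ j ] (Adj i j × Copy.emb B i ≡ x × Copy.emb B j ≡ y)

  record Design2 (N : ℕ) (λ′ : ℕ) : Set where
    field
      blocks : List (Copy N)
      balanced : ∀ x y → x ≢ y → Count (λ B → AdjInCopy B x y) blocks λ′

  SpanningDesign2 : ℕ → ℕ → Set
  SpanningDesign2 N λ′ = (vertices ≡ N) × Design2 N λ′

module Geometry {q : ℕ} (F : FiniteField q) where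
  open FiniteField F

  V : ℕ → Set
  V v = Vec Carrier v

  0v : ∀ {v} → V v
  0v = replicate _ 0#

  _+v_ : ∀ {v} → V v → V v → V v
  _+v_ = zipWith _+_

  _·_ : ∀ {v} → Carrier → V v → V v
  c · x = map (c *_) x

  NonZero : ∀ {v} → V v → Set
  NonZero x = x ≢ 0v

  -- points of PG(F^v) are represented by nonzero vectors; two such
  -- represent the same point iff they are proportional
  Point : ℕ → Set
  Point v = Σ (V v) NonZero

  _∼_ : ∀ {v} → V v → V v → Set
  x ∼ y = ∃[ c ] (x ≡ c · y)

  SamePoint : ∀ {v} → Point v → Point v → Set
  SamePoint (x , _) (y , _) = x ∼ y

  record IsLinearSubspace {v} (W : V v → Set) : Set where
    field
      has-0 : W 0v
      +-closed : ∀ {x y} → W x → W y → W (x +v y)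
      ·-closed : ∀ c {x} → W x → W (c · x)

  lincomb : ∀ {v n} → (Fin n → Carrier) → (Fin n → V v) → V v
  lincomb {n = zero}  c b = 0v
  lincomb {n = suc n} c b = (c Data.Fin.zero · b Data.Fin.zero) +v lincomb (λ i → c (Data.Fin.suc i)) (λ i → b (Data.Fin.suc i))

  InSpan : ∀ {v n} → (Fin n → V v) → V v → Set
  InSpan b x = ∃[ c ] (x ≡ lincomb c b)

  LinIndep : ∀ {v n} → (Fin n → V v) → Set
  LinIndep b = ∀ c → lincomb c b ≡ 0v → ∀ i → c i ≡ 0#

  -- an (n-1)-dimensional projective subspace, given by a basis of the
  -- corresponding n-dimensional linear subspace
  record ProjSubspace (v n : ℕ) : Set where
    field
      basis : Fin n → V v
      indep : LinIndep basis

  _∈ₛ_ : ∀ {v n} → V v → ProjSubspace v n → Set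
  x ∈ₛ S = InSpan (ProjSubspace.basis S) x

  record Spread (m n : ℕ) : Set where
    field
      classes : List (ProjSubspace (m ℕ.* n) n)
      partition : ∀ (x : V (m ℕ.* n)) → NonZero x → Count (x ∈ₛ_) classes 1

  module _ (Γ : SimpleGraph) where
    open SimpleGraph Γ

    record ΓSubspace (v : ℕ) : Set₁ where
      field
        emb : Fin vertices → Point v
        inj : ∀ i j → SamePoint (emb i) (emb j) → i ≡ j
        -- the vertex set is (the point set of) a subspace of PG(F^v)
        subspace : ∃[ W ] (IsLinearSubspace {v} W ×
                      (∀ (x : V v) → NonZero x →
                         (W x ⇔ (∃[ i ] (x ∼ proj₁ (emb i))))))

    AdjIn : ∀ {v} → ΓSubspace v → V v → V v → Set
    AdjIn B x y = ∃[ i ] ∃[ j ] (Adj i j ×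
                    x ∼ proj₁ (ΓSubspace.emb B i) ×
                    y ∼ proj₁ (ΓSubspace.emb B j))

    record DesignOver (v λ′ : ℕ) : Set₁ where
      field
        blocks : List (ΓSubspace v)
        balanced : ∀ (x y : V v) → NonZero x → NonZero y → ¬ (x ∼ y) →
                   Count (λ B → AdjIn B x y) blocks λ′

    record GDD (m n λ′ : ℕ) : Set₁ where
      field
        spread : Spread m n
        blocks : List (ΓSubspace (m ℕ.* n))
      SameClass : V (m ℕ.* n) → V (m ℕ.* n) → Set
      SameClass x y = Any (λ S → x ∈ₛ S × y ∈ₛ S) (Spread.classes spread)
      field
        no-edge-in-class : ∀ B → Any (B ≡_) blocks → ∀ i j → Adj i j →
          ¬ SameClass (proj₁ (ΓSubspace.emb B i))
                      (proj₁ (ΓSubspace.emb B j))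
        balanced : ∀ (x y : V (m ℕ.* n)) → NonZero x → NonZero y → ¬ SameClass x y →
                   Count (λ B → AdjIn B x y) blocks λ′

module Submission where

-- Put a copy of the spanning 2-([n]_q, Γ, λ) design on the points of every class of the spread:
-- the points of an (n-1)-dimensional projective space are in bijection with Fin [n]_q (normalised
-- coordinate vectors w.r.t. a basis of the class), and a spanning Γ-copy then covers the whole class,
-- so it is a Γ-subspace. Two points in the same class are adjacent in exactly λ of these copies and in
-- no GDD block; two points in different classes are adjacent in exactly λ GDD blocks and in no copy.

open import Level using (Level)
open import Data.Empty using (⊥-elim)
open import Data.Fin using (Fin; zero; suc; splitAt; join; combine; punchOut; finToFun; funToFin)
open import Data.Fin.Properties
  using (any?; pigeonhole; punchOut-injective; <-irrefl; +↔⊎; splitAt-join; finToFun-funToFin; funToFin-finToFin; inj⇒≟)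
import Data.Fin.Properties as Fin
open import Data.List using (List; []; _∷_; _++_; map; concatMap)
open import Data.List.Membership.Propositional using (_∈_)
open import Data.List.Membership.Propositional.Properties using (∈-map⁻)
open import Data.List.Relation.Unary.Any using (Any; here; there)
import Data.List.Relation.Unary.Any as Any
import Data.Nat as ℕ
open import Data.Nat using (ℕ; zero; suc; _^_; _≥_)
import Data.Nat.Properties as ℕₚ
open import Data.Product using (∃-syntax; _×_; _,_; proj₁; proj₂)
open import Data.Sum using (_⊎_; inj₁; inj₂)
import Data.Sum as Sum
open import Data.Vec using ([]; _∷_)
open import Data.Vec.Functional as Vector using (Vector)
open import Data.Vec.Functional.Relation.Unary.All using (All)
open import Function using (_∘_)
open import Function.Bundles using (Inverse; Injection; Equivalence; _⇔_; mk⇔)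
open import Function.Properties.Inverse using (Inverse⇒Injection; ↔-sym)
open import Relation.Binary.Definitions using (DecidableEquality)
open import Relation.Binary.PropositionalEquality
  using (_≡_; _≢_; _≗_; refl; sym; trans; cong; cong₂; subst; module ≡-Reasoning)
open import Relation.Nullary using (¬_; yes; no)
open import Defs

private variable
  a b : Level
  A : Set a
  B : Set b
  P Q : A → Set
  xs ys : List A
  j k : ℕ

Count-++ : Count P xs j → Count P ys k → Count P (xs ++ ys) (j ℕ.+ k)
Count-++ c-nil        d = d
Count-++ (c-yes p c) d = c-yes p (Count-++ c d)
Count-++ (c-no ¬p c) d = c-no ¬p (Count-++ c d)

Count-none : ∀ (xs : List A) → (∀ {x} → x ∈ xs → ¬ P x) → Count P xs 0
Count-none []       none = c-nil
Count-none (x ∷ xs) none = c-no (none (here refl)) (Count-none xs (none ∘ there))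

Count-zero-⊆ : (∀ {x} → Q x → P x) → Count P xs 0 → Count Q xs 0
Count-zero-⊆ Q⊆P c-nil       = c-nil
Count-zero-⊆ Q⊆P (c-no ¬p c) = c-no (¬p ∘ Q⊆P) (Count-zero-⊆ Q⊆P c)

Count-zero⇒¬Any : Count P xs 0 → ¬ Any P xs
Count-zero⇒¬Any (c-no ¬p c) (here p)  = ¬p p
Count-zero⇒¬Any (c-no ¬p c) (there a) = Count-zero⇒¬Any c a

Count-suc⇒Any : Count P xs (suc k) → Any P xs
Count-suc⇒Any (c-yes p c) = here p
Count-suc⇒Any (c-no ¬p c) = there (Count-suc⇒Any c)

Count-×-unique : Count P xs 1 → Count Q xs 1 →
                 Count (λ x → P x × Q x) xs 0 ⊎ Count (λ x → P x × Q x) xs 1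
Count-×-unique (c-yes p c) (c-yes q d) = inj₂ (c-yes (p , q) (Count-zero-⊆ proj₁ c))
Count-×-unique (c-yes p c) (c-no ¬q d) = inj₁ (c-no (¬q ∘ proj₂) (Count-zero-⊆ proj₁ c))
Count-×-unique (c-no ¬p c) (c-yes q d) = inj₁ (c-no (¬p ∘ proj₁) (Count-zero-⊆ proj₂ d))
Count-×-unique (c-no ¬p c) (c-no ¬q d) =
  Sum.map (c-no (¬p ∘ proj₁)) (c-no (¬p ∘ proj₁)) (Count-×-unique c d)

Count-map : {R : B → Set} (f : A → B) → (∀ x → R (f x) ⇔ P x) →
            Count P xs k → Count R (map f xs) k
Count-map f R∘f⇔P c-nil       = c-nil
Count-map f R∘f⇔P (c-yes p c) = c-yes (Equivalence.from (R∘f⇔P _) p) (Count-map f R∘f⇔P c)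
Count-map f R∘f⇔P (c-no ¬p c) = c-no (¬p ∘ Equivalence.to (R∘f⇔P _)) (Count-map f R∘f⇔P c)

Count-concatMap : {R : B → Set} {m : ℕ} (f : A → List B) →
                  (∀ {x} → P x → Count R (f x) m) → (∀ {x} → ¬ P x → Count R (f x) 0) →
                  Count P xs k → Count R (concatMap f xs) (k ℕ.* m)
Count-concatMap f yes-m no-0 c-nil       = c-nil
Count-concatMap f yes-m no-0 (c-yes p c) = Count-++ (yes-m p) (Count-concatMap f yes-m no-0 c)
Count-concatMap f yes-m no-0 (c-no ¬p c) = Count-++ (no-0 ¬p) (Count-concatMap f yes-m no-0 c)

funToFin-cong : ∀ {m n} {f g : Fin m → Fin n} → f ≗ g → funToFin f ≡ funToFin g
funToFin-cong {zero}  f≗g = refl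
funToFin-cong {suc m} f≗g = cong₂ combine (f≗g zero) (funToFin-cong (f≗g ∘ suc))

injective⇒surjective : ∀ {m n} → n ℕ.≤ m → (f : Fin m → Fin n) →
                       (∀ {i j} → f i ≡ f j → i ≡ j) → ∀ k → ∃[ i ] f i ≡ k
injective⇒surjective {n = suc n} n≤m f f-inj k with any? (λ i → f i Fin.≟ k)
... | yes hit = hit
... | no miss =
  let i , j , i<j , gi≡gj = pigeonhole n≤m (λ i → punchOut (avoids i))
  in ⊥-elim (<-irrefl (f-inj (punchOut-injective (avoids i) (avoids j) gi≡gj)) i<j)
  where
    avoids : ∀ i → k ≢ f i
    avoids i k≡fi = miss (i , sym k≡fi)

module FieldProperties (K : Field) where
  open Field K
  open ≡-Reasoning

  +-identityʳ : ∀ x → x + 0# ≡ x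
  +-identityʳ x = trans (+-comm x 0#) (+-identityˡ x)

  *-identityʳ : ∀ x → x * 1# ≡ x
  *-identityʳ x = trans (*-comm x 1#) (*-identityˡ x)

  distribʳ : ∀ x y z → (y + z) * x ≡ y * x + z * x
  distribʳ x y z = trans (*-comm (y + z) x) (trans (distribˡ x y z) (cong₂ _+_ (*-comm x y) (*-comm x z)))

  +-interchange : ∀ w x y z → (w + x) + (y + z) ≡ (w + y) + (x + z)
  +-interchange w x y z = begin
    (w + x) + (y + z) ≡⟨ +-assoc w x (y + z) ⟩
    w + (x + (y + z)) ≡⟨ cong (w +_) (sym (+-assoc x y z)) ⟩
    w + ((x + y) + z) ≡⟨ cong (λ t → w + (t + z)) (+-comm x y) ⟩
    w + ((y + x) + z) ≡⟨ cong (w +_) (+-assoc y x z) ⟩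
    w + (y + (x + z)) ≡⟨ sym (+-assoc w y (x + z)) ⟩
    (w + y) + (x + z) ∎

  x≡x+x⇒x≡0 : ∀ x → x ≡ x + x → x ≡ 0#
  x≡x+x⇒x≡0 x x≡x+x = begin
    x               ≡⟨ sym (+-identityˡ x) ⟩
    0# + x          ≡⟨ cong (_+ x) (sym (-‿inverseˡ x)) ⟩
    ((- x) + x) + x ≡⟨ +-assoc (- x) x x ⟩
    (- x) + (x + x) ≡⟨ cong ((- x) +_) (sym x≡x+x) ⟩
    (- x) + x       ≡⟨ -‿inverseˡ x ⟩
    0#              ∎

  zeroʳ : ∀ x → x * 0# ≡ 0#
  zeroʳ x = x≡x+x⇒x≡0 (x * 0#) (trans (cong (x *_) (sym (+-identityˡ 0#))) (distribˡ x 0# 0#))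

  zeroˡ : ∀ x → 0# * x ≡ 0#
  zeroˡ x = trans (*-comm 0# x) (zeroʳ x)

  y*x≡1⇒y*[x*z]≡z : ∀ {x y} → y * x ≡ 1# → ∀ z → y * (x * z) ≡ z
  y*x≡1⇒y*[x*z]≡z {x} {y} y*x≡1 z = begin
    y * (x * z) ≡⟨ sym (*-assoc y x z) ⟩
    (y * x) * z ≡⟨ cong (_* z) y*x≡1 ⟩
    1# * z      ≡⟨ *-identityˡ z ⟩
    z           ∎

  -1# : Carrier
  -1# = - 1#

  1+-1≡0 : 1# + -1# ≡ 0#
  1+-1≡0 = trans (+-comm 1# -1#) (-‿inverseˡ 1#)

  x+-1*y≡0⇒x≡y : ∀ x y → x + -1# * y ≡ 0# → x ≡ y
  x+-1*y≡0⇒x≡y x y x-y≡0 = begin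
    x                     ≡⟨ sym (+-identityʳ x) ⟩
    x + 0#                ≡⟨ cong (x +_) (sym -y+y≡0) ⟩
    x + (-1# * y + y)     ≡⟨ sym (+-assoc x (-1# * y) y) ⟩
    (x + -1# * y) + y     ≡⟨ cong (_+ y) x-y≡0 ⟩
    0# + y                ≡⟨ +-identityˡ y ⟩
    y                     ∎
    where
    -y+y≡0 : -1# * y + y ≡ 0#
    -y+y≡0 = begin
      -1# * y + y       ≡⟨ cong (-1# * y +_) (sym (*-identityˡ y)) ⟩
      -1# * y + 1# * y  ≡⟨ sym (distribʳ y -1# 1#) ⟩
      (-1# + 1#) * y    ≡⟨ cong (_* y) (-‿inverseˡ 1#) ⟩
      0# * y            ≡⟨ zeroˡ y ⟩
      0#                ∎

module Coordinates {q : ℕ} (F : FiniteField q) where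
  open FiniteField F
  open FieldProperties field′
  open Inverse card using (to; from; strictlyInverseʳ)
  open Injection (Inverse⇒Injection (↔-sym card)) using () renaming (injective to from-injective)
  open ≡-Reasoning

  _≟_ : DecidableEquality Carrier
  _≟_ = inj⇒≟ (Inverse⇒Injection card)

  _⋆_ : ∀ {n} → Carrier → Vector Carrier n → Vector Carrier n
  e ⋆ c = Vector.map (e *_) c

  _∝_ : ∀ {n} → Vector Carrier n → Vector Carrier n → Set
  c ∝ d = ∃[ e ] c ≗ e ⋆ d

  enum : ∀ n → Fin (q ^ n) → Vector Carrier n
  enum n a i = from (finToFun {q} {n} a i)

  enum-injective : ∀ n {a b} → enum n a ≗ enum n b → a ≡ b
  enum-injective n {a} {b} eq = begin
    a                             ≡⟨ sym (funToFin-finToFin {n} {q} a) ⟩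
    funToFin (finToFun {q} {n} a) ≡⟨ funToFin-cong (from-injective ∘ eq) ⟩
    funToFin (finToFun {q} {n} b) ≡⟨ funToFin-finToFin {n} {q} b ⟩
    b                             ∎

  enum-surjective : ∀ n (c : Vector Carrier n) → ∃[ a ] c ≗ enum n a
  enum-surjective n c = funToFin (to ∘ c) , λ i →
    sym (trans (cong from (finToFun-funToFin (to ∘ c) i)) (strictlyInverseʳ (c i)))

  -- rep n k is a point of PG(F_q^n) with first nonzero coordinate 1:
  -- Fin [n+1]_q = Fin (q^n + [n]_q) lists first the vectors (1, a), then the vectors (0, p).
  rep′ : ∀ n → Fin (q ^ n) ⊎ Fin ([ n ] q) → Vector Carrier (suc n)
  rep : ∀ n → Fin ([ n ] q) → Vector Carrier n

  rep′ n (inj₁ a) = 1# Vector.∷ enum n a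
  rep′ n (inj₂ p) = 0# Vector.∷ rep n p

  rep (suc n) k = rep′ n (splitAt (q ^ n) k)

  rep-join : ∀ n s → rep (suc n) (join (q ^ n) ([ n ] q) s) ≡ rep′ n s
  rep-join n s = cong (rep′ n) (splitAt-join (q ^ n) ([ n ] q) s)

  rep′-nonzero : ∀ n s → ¬ All (_≡ 0#) (rep′ n s)
  rep-nonzero : ∀ n k → ¬ All (_≡ 0#) (rep n k)

  rep′-nonzero n (inj₁ a) zero-vec = 0≢1 (sym (zero-vec zero))
  rep′-nonzero n (inj₂ p) zero-vec = rep-nonzero n p (zero-vec ∘ suc)

  rep-nonzero (suc n) k = rep′-nonzero n (splitAt (q ^ n) k)

  rep′-injective : ∀ n {s t} → rep′ n s ∝ rep′ n t → s ≡ t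
  rep-injective : ∀ n {k l} → rep n k ∝ rep n l → k ≡ l

  rep′-injective n {inj₁ a} {inj₁ b} (e , eq) = cong inj₁ (enum-injective n λ i →
    trans (eq (suc i)) (trans (cong (_* enum n b i) e≡1) (*-identityˡ _)))
    where
    e≡1 : e ≡ 1#
    e≡1 = sym (trans (eq zero) (*-identityʳ e))
  rep′-injective n {inj₁ a} {inj₂ r} (e , eq) = ⊥-elim (0≢1 (sym (trans (eq zero) (zeroʳ e))))
  rep′-injective n {inj₂ p} {inj₁ b} (e , eq) = ⊥-elim (rep-nonzero n p λ i →
    trans (eq (suc i)) (trans (cong (_* enum n b i) e≡0) (zeroˡ _)))
    where
    e≡0 : e ≡ 0#
    e≡0 = sym (trans (eq zero) (*-identityʳ e))
  rep′-injective n {inj₂ p} {inj₂ r} (e , eq) = cong inj₂ (rep-injective n (e , eq ∘ suc))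

  rep-injective (suc n) k∝l =
    Injection.injective (Inverse⇒Injection (+↔⊎ {q ^ n} {[ n ] q})) (rep′-injective n k∝l)

  rep′-surjective : ∀ n (c : Vector Carrier (suc n)) → ¬ All (_≡ 0#) c → ∃[ s ] c ∝ rep′ n s
  rep-surjective : ∀ n (c : Vector Carrier n) → ¬ All (_≡ 0#) c → ∃[ k ] c ∝ rep n k

  rep′-surjective n c c≢0 with c zero ≟ 0#
  ... | yes c₀≡0 =
    let k , d , eq = rep-surjective n (Vector.tail c) (c≢0 ∘ extend)
    in inj₂ k , d , λ { zero → trans c₀≡0 (sym (zeroʳ d)) ; (suc i) → eq i }
    where
    extend : All (_≡ 0#) (Vector.tail c) → All (_≡ 0#) c
    extend tail≡0 zero    = c₀≡0
    extend tail≡0 (suc i) = tail≡0 i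
  ... | no c₀≢0 =
    let c₀⁻¹ , c₀⁻¹*c₀≡1 = inverse (c zero) c₀≢0
        a , eq = enum-surjective n (c₀⁻¹ ⋆ Vector.tail c)
        c₀*c₀⁻¹≡1 = trans (*-comm (c zero) c₀⁻¹) c₀⁻¹*c₀≡1
    in inj₁ a , c zero , λ
      { zero    → sym (*-identityʳ (c zero))
      ; (suc i) → trans (sym (y*x≡1⇒y*[x*z]≡z c₀*c₀⁻¹≡1 (c (suc i)))) (cong (c zero *_) (eq i))
      }

  rep-surjective zero    c c≢0 = ⊥-elim (c≢0 λ ())
  rep-surjective (suc n) c c≢0 =
    let s , c∝s = rep′-surjective n c c≢0
    in join (q ^ n) ([ n ] q) s , subst (c ∝_) (sym (rep-join n s)) c∝s

module LinearAlgebra {q : ℕ} (F : FiniteField q) where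
  open FiniteField F
  open FieldProperties field′
  open Coordinates F using (_⋆_)
  open Geometry F
  open ≡-Reasoning

  private variable
    v n : ℕ
    x y z : V v

  ·-zeroʳ : ∀ e → e · 0v {v} ≡ 0v
  ·-zeroʳ {zero}  e = refl
  ·-zeroʳ {suc v} e = cong₂ _∷_ (zeroʳ e) (·-zeroʳ e)

  ·-zeroˡ : ∀ (x : V v) → 0# · x ≡ 0v
  ·-zeroˡ []      = refl
  ·-zeroˡ (a ∷ x) = cong₂ _∷_ (zeroˡ a) (·-zeroˡ x)

  ·-identityˡ : ∀ (x : V v) → 1# · x ≡ x
  ·-identityˡ []      = refl
  ·-identityˡ (a ∷ x) = cong₂ _∷_ (*-identityˡ a) (·-identityˡ x)

  ·-assoc : ∀ e d (x : V v) → e · (d · x) ≡ (e * d) · x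
  ·-assoc e d []      = refl
  ·-assoc e d (a ∷ x) = cong₂ _∷_ (sym (*-assoc e d a)) (·-assoc e d x)

  ·-distribˡ : ∀ e (x y : V v) → e · (x +v y) ≡ (e · x) +v (e · y)
  ·-distribˡ e []      []      = refl
  ·-distribˡ e (a ∷ x) (b ∷ y) = cong₂ _∷_ (distribˡ e a b) (·-distribˡ e x y)

  ·-distribʳ : ∀ c d (x : V v) → (c · x) +v (d · x) ≡ (c + d) · x
  ·-distribʳ c d []      = refl
  ·-distribʳ c d (a ∷ x) = cong₂ _∷_ (sym (distribʳ a c d)) (·-distribʳ c d x)

  0v+v0v : 0v {v} +v 0v ≡ 0v
  0v+v0v {zero}  = refl
  0v+v0v {suc v} = cong₂ _∷_ (+-identityˡ 0#) 0v+v0v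

  +v-interchange : ∀ (w x y z : V v) → (w +v x) +v (y +v z) ≡ (w +v y) +v (x +v z)
  +v-interchange []      []      []      []      = refl
  +v-interchange (a ∷ w) (b ∷ x) (c ∷ y) (d ∷ z) =
    cong₂ _∷_ (+-interchange a b c d) (+v-interchange w x y z)

  lincomb-cong : ∀ {c d : Vector Carrier n} (β : Fin n → V v) → c ≗ d → lincomb c β ≡ lincomb d β
  lincomb-cong {zero}  β c≗d = refl
  lincomb-cong {suc n} β c≗d =
    cong₂ _+v_ (cong (_· β zero) (c≗d zero)) (lincomb-cong (β ∘ suc) (c≗d ∘ suc))

  lincomb-zero : ∀ {c : Vector Carrier n} (β : Fin n → V v) → All (_≡ 0#) c → lincomb c β ≡ 0v
  lincomb-zero {zero}  β c≡0 = refl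
  lincomb-zero {suc n} β c≡0 = trans (cong₂ _+v_ head≡0 (lincomb-zero (β ∘ suc) (c≡0 ∘ suc))) 0v+v0v
    where head≡0 = trans (cong (_· β zero) (c≡0 zero)) (·-zeroˡ (β zero))

  lincomb-⋆ : ∀ e (c : Vector Carrier n) (β : Fin n → V v) → e · lincomb c β ≡ lincomb (e ⋆ c) β
  lincomb-⋆ {zero}  e c β = ·-zeroʳ e
  lincomb-⋆ {suc n} e c β = trans (·-distribˡ e _ _)
    (cong₂ _+v_ (·-assoc e (c zero) (β zero)) (lincomb-⋆ e (c ∘ suc) (β ∘ suc)))

  lincomb-+ : ∀ (c d : Vector Carrier n) (β : Fin n → V v) →
              lincomb c β +v lincomb d β ≡ lincomb (λ i → c i + d i) β
  lincomb-+ {zero}  c d β = 0v+v0v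
  lincomb-+ {suc n} c d β = trans (+v-interchange _ _ _ _)
    (cong₂ _+v_ (·-distribʳ (c zero) (d zero) (β zero)) (lincomb-+ (c ∘ suc) (d ∘ suc) (β ∘ suc)))

  -- Independence is only stated for the value 0v, so compare c with d through c + (-1) d.
  lincomb-injective : ∀ {β : Fin n → V v} → LinIndep β → ∀ {c d} → lincomb c β ≡ lincomb d β → c ≗ d
  lincomb-injective {β = β} indep {c} {d} eq i =
    x+-1*y≡0⇒x≡y (c i) (d i) (indep (λ i → c i + -1# * d i) c-d↦0 i)
    where
    c-d↦0 : lincomb (λ i → c i + -1# * d i) β ≡ 0v
    c-d↦0 = begin
      lincomb (λ i → c i + -1# * d i) β        ≡⟨ sym (lincomb-+ c (-1# ⋆ d) β) ⟩
      lincomb c β +v lincomb (-1# ⋆ d) β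
        ≡⟨ cong₂ _+v_ (trans eq (sym (·-identityˡ _))) (sym (lincomb-⋆ -1# d β)) ⟩
      (1# · lincomb d β) +v (-1# · lincomb d β) ≡⟨ ·-distribʳ 1# -1# (lincomb d β) ⟩
      (1# + -1#) · lincomb d β                 ≡⟨ cong (_· lincomb d β) 1+-1≡0 ⟩
      0# · lincomb d β                         ≡⟨ ·-zeroˡ (lincomb d β) ⟩
      0v                                       ∎

  ∼-trans : x ∼ y → y ∼ z → x ∼ z
  ∼-trans {z = z} (e , x≡ey) (d , y≡dz) = e * d , trans x≡ey (trans (cong (e ·_) y≡dz) (·-assoc e d z))

  ∼-sym : NonZero x → x ∼ y → y ∼ x
  ∼-sym {x = x} {y} x≢0 (e , x≡ey) =
    let e⁻¹ , e⁻¹*e≡1 = inverse e e≢0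
    in e⁻¹ , (begin
      y               ≡⟨ sym (·-identityˡ y) ⟩
      1# · y          ≡⟨ cong (_· y) (sym e⁻¹*e≡1) ⟩
      (e⁻¹ * e) · y   ≡⟨ sym (·-assoc e⁻¹ e y) ⟩
      e⁻¹ · (e · y)   ≡⟨ cong (e⁻¹ ·_) (sym x≡ey) ⟩
      e⁻¹ · x         ∎)
    where
    e≢0 : e ≢ 0#
    e≢0 e≡0 = x≢0 (trans x≡ey (trans (cong (_· y) e≡0) (·-zeroˡ y)))

  ∈ₛ-isLinearSubspace : (S : ProjSubspace v n) → IsLinearSubspace (_∈ₛ S)
  ∈ₛ-isLinearSubspace S = record
    { has-0    = (λ _ → 0#) , sym (lincomb-zero β (λ _ → refl))
    ; +-closed = λ { (c , x≡) (d , y≡) →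
                     (λ i → c i + d i) , trans (cong₂ _+v_ x≡ y≡) (lincomb-+ c d β) }
    ; ·-closed = λ { e (c , x≡) → e ⋆ c , trans (cong (e ·_) x≡) (lincomb-⋆ e c β) }
    }
    where β = ProjSubspace.basis S

  ∈ₛ-resp-∼ : (S : ProjSubspace v n) → x ∼ y → y ∈ₛ S → x ∈ₛ S
  ∈ₛ-resp-∼ S (e , x≡ey) y∈S =
    subst (_∈ₛ S) (sym x≡ey) (IsLinearSubspace.·-closed (∈ₛ-isLinearSubspace S) e y∈S)

module PointsOf {q : ℕ} (F : FiniteField q) {v n : ℕ} (S : Geometry.ProjSubspace F v n) where
  open Coordinates F
  open LinearAlgebra F
  open Geometry F
  open ProjSubspace S

  point : Fin ([ n ] q) → V v
  point k = lincomb (rep n k) basis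

  point-∈ₛ : ∀ k → point k ∈ₛ S
  point-∈ₛ k = rep n k , refl

  point-nonzero : ∀ {k} → NonZero (point k)
  point-nonzero {k} point≡0 = rep-nonzero n k (indep (rep n k) point≡0)

  point-injective : ∀ {k l} → point k ∼ point l → k ≡ l
  point-injective {k} {l} (e , eq) =
    rep-injective n (e , lincomb-injective indep (trans eq (lincomb-⋆ e (rep n l) basis)))

  ∈ₛ⇒∼point : ∀ {x} → NonZero x → x ∈ₛ S → ∃[ k ] x ∼ point k
  ∈ₛ⇒∼point x≢0 (c , x≡) =
    let k , d , c≗ = rep-surjective n c (λ c≡0 → x≢0 (trans x≡ (lincomb-zero basis c≡0)))
    in k , d , trans x≡ (trans (lincomb-cong basis c≗) (sym (lincomb-⋆ d (rep n k) basis)))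

  ∼point-unique : ∀ {x k l} → NonZero x → x ∼ point k → x ∼ point l → k ≡ l
  ∼point-unique x≢0 x∼k x∼l = point-injective (∼-trans (∼-sym x≢0 x∼k) x∼l)

module Lift {q : ℕ} (F : FiniteField q) (Γ : SimpleGraph) {n : ℕ}
            (spanning : SimpleGraph.vertices Γ ≡ [ n ] q)
            {v : ℕ} (S : Geometry.ProjSubspace F v n) where
  open Geometry F
  open LinearAlgebra F
  open PointsOf F S

  lift : Copy Γ ([ n ] q) → ΓSubspace Γ v
  lift C = record
    { emb      = λ i → point (emb i) , point-nonzero
    ; inj      = λ i j i∼j → inj i j (point-injective i∼j)
    ; subspace = (_∈ₛ S) , ∈ₛ-isLinearSubspace S , λ x x≢0 →
                   mk⇔ (covered x≢0) (λ (i , x∼i) → ∈ₛ-resp-∼ S x∼i (point-∈ₛ (emb i)))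
    }
    where
    open Copy C
    covered : ∀ {x} → NonZero x → x ∈ₛ S → ∃[ i ] x ∼ point (emb i)
    covered x≢0 x∈S with k , x∼k ← ∈ₛ⇒∼point x≢0 x∈S
                    with i , refl ← injective⇒surjective (ℕₚ.≤-reflexive (sym spanning)) emb (inj _ _) k
                    = i , x∼k

  AdjIn-lift⇒∈ₛ : ∀ C {x y} → AdjIn Γ (lift C) x y → x ∈ₛ S × y ∈ₛ S
  AdjIn-lift⇒∈ₛ C (i , j , _ , x∼i , y∼j) =
    ∈ₛ-resp-∼ S x∼i (point-∈ₛ (Copy.emb C i)) ,
    ∈ₛ-resp-∼ S y∼j (point-∈ₛ (Copy.emb C j))

  AdjIn-lift⇔ : ∀ {x y k l} → NonZero x → NonZero y → x ∼ point k → y ∼ point l →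
                ∀ C → AdjIn Γ (lift C) x y ⇔ AdjInCopy Γ C k l
  AdjIn-lift⇔ {x} {y} x≢0 y≢0 x∼k y∼l C = mk⇔
    (λ (i , j , adj , x∼i , y∼j) →
      i , j , adj , ∼point-unique x≢0 x∼i x∼k , ∼point-unique y≢0 y∼j y∼l)
    (λ (i , j , adj , i↦k , j↦l) →
      i , j , adj , subst (λ t → x ∼ point t) (sym i↦k) x∼k , subst (λ t → y ∼ point t) (sym j↦l) y∼l)

  module _ {λ′ : ℕ} (D : Design2 Γ ([ n ] q) λ′) where
    open Design2 D

    lift-balanced : ∀ {x y} → NonZero x → NonZero y → ¬ x ∼ y → x ∈ₛ S × y ∈ₛ S →
                    Count (λ B → AdjIn Γ B x y) (map lift blocks) λ′
    lift-balanced {x} {y} x≢0 y≢0 x≁y (x∈S , y∈S) =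
      let k , x∼k = ∈ₛ⇒∼point x≢0 x∈S
          l , y∼l = ∈ₛ⇒∼point y≢0 y∈S
          k≢l = λ k≡l → x≁y (∼-trans x∼k (∼-sym y≢0 (subst (λ t → y ∼ point t) (sym k≡l) y∼l)))
      in Count-map lift (AdjIn-lift⇔ x≢0 y≢0 x∼k y∼l) (balanced k l k≢l)

    lift-outside : ∀ {x y} → ¬ (x ∈ₛ S × y ∈ₛ S) → Count (λ B → AdjIn Γ B x y) (map lift blocks) 0
    lift-outside {x} {y} ¬both = Count-none _ no-adj
      where
      no-adj : ∀ {B} → B ∈ map lift blocks → ¬ AdjIn Γ B x y
      no-adj B∈ with C , _ , refl ← ∈-map⁻ lift B∈ = ¬both ∘ AdjIn-lift⇒∈ₛ C

module Gluing {q : ℕ} (F : FiniteField q) (Γ : SimpleGraph) {m n λ′ : ℕ}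
              (G : Geometry.GDD F Γ m n λ′)
              (spanning : SimpleGraph.vertices Γ ≡ [ n ] q) (D : Design2 Γ ([ n ] q) λ′) where
  open Geometry F
  open LinearAlgebra F
  open GDD G using (spread; SameClass; no-edge-in-class)
  open Spread spread using (classes; partition)

  classBlocks : ProjSubspace (m ℕ.* n) n → List (ΓSubspace Γ (m ℕ.* n))
  classBlocks S = map (Lift.lift F Γ spanning S) (Design2.blocks D)

  gdd-sameClass : ∀ {x y} → NonZero x → NonZero y → SameClass x y →
                  Count (λ B → AdjIn Γ B x y) (GDD.blocks G) 0
  gdd-sameClass x≢0 y≢0 same = Count-none _ λ B∈ (i , j , adj , x∼i , y∼j) →
    no-edge-in-class _ B∈ i j adj
      (Any.map (λ {S} (x∈S , y∈S) →
                  ∈ₛ-resp-∼ S (∼-sym x≢0 x∼i) x∈S , ∈ₛ-resp-∼ S (∼-sym y≢0 y∼j) y∈S) same)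

  classBlocks-count : ∀ {x y k} → NonZero x → NonZero y → ¬ x ∼ y →
                      Count (λ S → x ∈ₛ S × y ∈ₛ S) classes k →
                      Count (λ B → AdjIn Γ B x y) (concatMap classBlocks classes) (k ℕ.* λ′)
  classBlocks-count x≢0 y≢0 x≁y = Count-concatMap classBlocks
    (λ {S} → Lift.lift-balanced F Γ spanning S D x≢0 y≢0 x≁y)
    (λ {S} → Lift.lift-outside F Γ spanning S D)

  gluedBlocks : List (ΓSubspace Γ (m ℕ.* n))
  gluedBlocks = GDD.blocks G ++ concatMap classBlocks classes

  gluedBlocks-balanced : ∀ x y → NonZero x → NonZero y → ¬ x ∼ y →
                         Count (λ B → AdjIn Γ B x y) gluedBlocks λ′
  gluedBlocks-balanced x y x≢0 y≢0 x≁y with Count-×-unique (partition x x≢0) (partition y y≢0)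
  ... | inj₁ apart    = subst (Count _ _) (ℕₚ.+-identityʳ λ′) (Count-++
    (GDD.balanced G x y x≢0 y≢0 (Count-zero⇒¬Any apart))
    (classBlocks-count x≢0 y≢0 x≁y apart))
  ... | inj₂ together = subst (Count _ _) (ℕₚ.+-identityʳ λ′) (Count-++
    (gdd-sameClass x≢0 y≢0 (Count-suc⇒Any together))
    (classBlocks-count x≢0 y≢0 x≁y together))

  design : DesignOver Γ (m ℕ.* n) λ′
  design = record { blocks = gluedBlocks ; balanced = gluedBlocks-balanced }

open import Data.Nat using (_*_)

corollary4p8 : (q : ℕ) (F : FiniteField q) (m n λ′ : ℕ) → m ≥ 1 → n ≥ 1 → λ′ ≥ 1 →
    (Γ : SimpleGraph) →
    Geometry.GDD F Γ m n λ′ →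
    SpanningDesign2 Γ ([ n ] q) λ′ →
    Geometry.DesignOver F Γ (m * n) λ′
corollary4p8 q F m n λ′ _ _ _ Γ G (spanning , D) = Gluing.design F Γ G spanning D
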